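{- Unrestricted monotonicity fails for RJ-consequence in both forms: (a) (AMON fails) there exist finite sets $\mathcal H,\mathcal D$, a degree of rejection $r$, formulas $\gamma,\delta\in\mathrm{Fm}_{\mathcal D}$ and $\varphi\in\mathrm{Fm}_{\mathcal H}$ such that $\gamma\mid\hspace{ -2.4pt}\sim_{RJ}\varphi$ but $\gamma\wedge\delta\not\mid\hspace{ -2.4pt}\sim_{RJ}\varphi$; (b) (MMON fails) there exist finite sets $\mathcal H,\mathcal D$, a degree of rejection $r$, multisets $\Delta,\Delta'\in\mathcal M_{\mathcal D}$ and $\varphi\in\mathrm{Fm}_{\mathcal H}$ such that $\Delta\mid\hspace{ -2.4pt}\sim_{RJ}\varphi$ but $\Delta,\Delta'\not\mid\hspace{ -2.4pt}\sim_{RJ}\varphi$ (where $\Delta,\Delta'$ is the multiset union).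
   Context: $\mathcal H=\{H_1,\dots,H_n\}$ and $\mathcal D=\{d_1,\dots,d_l\}$ are finite sets of propositional variables (not necessarily disjoint); $\mathrm{Fm}_{\mathcal H}$, $\mathrm{Fm}_{\mathcal D}$ are the classical propositional formulas over them built with $\wedge,\vee,\neg$; $\models$ is classical consequence. $T:=\bigvee_{H\in\mathcal H}H\wedge\bigwedge_{H\neq H'}(H\rightarrow\neg H')$. $\mathcal M_{\mathcal D}$ is the set of finite multisets of formulas of $\mathrm{Fm}_{\mathcal D}$; a single formula is identified with the singleton multiset. A degree of rejection is a map $r:\mathcal M_{\mathcal D}\times\mathcal H\to[0,\infty)\cup\{\infty\}$, $(\Delta,H)\mapsto r_\Delta(H)$, such that for all $\gamma,\delta\in\mathrm{Fm}_{\mathcal D}$, $\Delta$, $H$: (1) if $T,\gamma\models\delta$ then $r_\gamma(H)\ge r_\delta(H)$; (2) if $T,H\models\delta$ then $r_\delta(H)=0$; (3) if $T,\delta\models\neg H$ then $r_\delta(H)>0$; (4) if $r_\Delta(H)\neq\infty$ then $r_\Delta(H)=\sum_{\delta\in\Delta}r_\delta(H)$ (over occurrences). $\hat{\mathcal H}_\Delta$ is the set of $H$ with $r_\Delta(H)<\infty$ minimizing $r_\Delta$ among hypotheses with finite value. For $\varphi\in\mathrm{Fm}_{\mathcal H}$, $\Delta\mid\hspace{ -2.4pt}\sim_{RJ}\varphi$ iff $T,H\models\varphi$ for every $H\in\hat{\mathcal H}_\Delta$. -}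

module Defs where

open import Data.Nat using (ℕ)
open import Data.Bool using (Bool; true; false; _∧_; _∨_; not)
open import Data.List using (List; []; _∷_; _++_)
open import Data.List.Membership.Propositional using (_∈_)
open import Data.List.Relation.Unary.All using (All)
open import Data.List.Relation.Unary.Any using (Any)
open import Data.List.Relation.Binary.Permutation.Propositional using (_↭_)
open import Data.Rational using (ℚ; 0ℚ) renaming (_+_ to _+ℚ_; _≤_ to _≤ℚ_; _<_ to _<ℚ_)
open import Data.Product using (_×_; Σ; ∃; ∃-syntax; _,_)
open import Data.Empty using (⊥)
open import Data.Unit using (⊤)
open import Relation.Binary.PropositionalEquality using (_≡_; _≢_)
open import Relation.Nullary using (¬_)

data Fm : Set where
  var  : ℕ → Fm
  _∧ᶠ_ : Fm → Fm → Fm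
  _∨ᶠ_ : Fm → Fm → Fm
  ¬ᶠ_  : Fm → Fm

Valuation : Set
Valuation = ℕ → Bool

⟦_⟧ : Fm → Valuation → Bool
⟦ var x ⟧ v = v x
⟦ φ ∧ᶠ ψ ⟧ v = ⟦ φ ⟧ v ∧ ⟦ ψ ⟧ v
⟦ φ ∨ᶠ ψ ⟧ v = ⟦ φ ⟧ v ∨ ⟦ ψ ⟧ v
⟦ ¬ᶠ φ ⟧ v = not (⟦ φ ⟧ v)

atoms : Fm → List ℕ
atoms (var x) = x ∷ []
atoms (φ ∧ᶠ ψ) = atoms φ ++ atoms ψ
atoms (φ ∨ᶠ ψ) = atoms φ ++ atoms ψ
atoms (¬ᶠ φ) = atoms φ

InFm : List ℕ → Fm → Set
InFm V φ = All (_∈ V) (atoms φ)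

-- The background theory T (for hypothesis set 𝓗), evaluated under v:
-- T = ⋁_{H∈𝓗} H ∧ ⋀_{H≠H'} (H → ¬H').

SatT : List ℕ → Valuation → Set
SatT 𝓗 v = Any (λ H → v H ≡ true) 𝓗
         × (∀ {H H'} → H ∈ 𝓗 → H' ∈ 𝓗 → H ≢ H' → v H ≡ true → v H' ≡ false)

_,_⊨_ : List ℕ → List Fm → Fm → Set
𝓗 , Γ ⊨ φ = ∀ (v : Valuation) → SatT 𝓗 v → All (λ γ → ⟦ γ ⟧ v ≡ true) Γ → ⟦ φ ⟧ v ≡ true

data Val : Set where
  fin : ℚ → Val
  ∞   : Val

_⊕_ : Val → Val → Val
fin a ⊕ fin b = fin (a +ℚ b)
fin _ ⊕ ∞ = ∞
∞ ⊕ _ = ∞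

_≥ᵛ_ : Val → Val → Set
∞ ≥ᵛ _ = ⊤
fin _ ≥ᵛ ∞ = ⊥
fin a ≥ᵛ fin b = b ≤ℚ a
infix 4 _≥ᵛ_

Pos : Val → Set
Pos (fin a) = 0ℚ <ℚ a
Pos ∞ = ⊤

NonNeg : Val → Set
NonNeg (fin a) = 0ℚ ≤ℚ a
NonNeg ∞ = ⊤

Finite : Val → Set
Finite (fin _) = ⊤
Finite ∞ = ⊥

-- Multisets of formulas are represented as lists, taken up to permutation.
Multiset : Set
Multiset = List Fm

sumVal : List Val → Val
sumVal [] = fin 0ℚ
sumVal (x ∷ xs) = x ⊕ sumVal xs

mapL : {A B : Set} → (A → B) → List A → List B
mapL f [] = []
mapL f (x ∷ xs) = f x ∷ mapL f xs

record IsDegreeOfRejection (𝓗 𝓓 : List ℕ) (r : Multiset → ℕ → Val) : Set where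
  field
    nonneg   : ∀ Δ H → All (InFm 𝓓) Δ → H ∈ 𝓗 → NonNeg (r Δ H)
    multiset : ∀ Δ Δ' H → All (InFm 𝓓) Δ → Δ ↭ Δ' → H ∈ 𝓗 → r Δ H ≡ r Δ' H
    cond1 : ∀ γ δ H → InFm 𝓓 γ → InFm 𝓓 δ → H ∈ 𝓗 →
            𝓗 , (γ ∷ []) ⊨ δ → r (γ ∷ []) H ≥ᵛ r (δ ∷ []) H
    cond2 : ∀ δ H → InFm 𝓓 δ → H ∈ 𝓗 →
            𝓗 , (var H ∷ []) ⊨ δ → r (δ ∷ []) H ≡ fin 0ℚ
    cond3 : ∀ δ H → InFm 𝓓 δ → H ∈ 𝓗 →
            𝓗 , (δ ∷ []) ⊨ (¬ᶠ var H) → Pos (r (δ ∷ []) H)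
    cond4 : ∀ Δ H → All (InFm 𝓓) Δ → H ∈ 𝓗 →
            r Δ H ≢ ∞ → r Δ H ≡ sumVal (mapL (λ δ → r (δ ∷ []) H) Δ)

_≤fin_ : Val → Val → Set
fin a ≤fin fin b = a ≤ℚ b
_ ≤fin _ = ⊤

Minimal : List ℕ → (Multiset → ℕ → Val) → Multiset → ℕ → Set
Minimal 𝓗 r Δ H = H ∈ 𝓗 × Finite (r Δ H)
                × (∀ H' → H' ∈ 𝓗 → Finite (r Δ H') → r Δ H ≤fin r Δ H')

RJ : List ℕ → (Multiset → ℕ → Val) → Multiset → Fm → Set
RJ 𝓗 r Δ φ = ∀ H → Minimal 𝓗 r Δ H → 𝓗 , (var H ∷ []) ⊨ φ

-- Take the degree of rejection that charges each datum 1 if it fails, and 0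
-- if it holds, in the model of T where exactly the hypothesis H is true.
-- Then H₀ alone is best supported by the datum H₀, so H₀ |~ H₀.  Adding the
-- contradictory conjunct ¬H₀, or the further datum H₁, makes H₀ and H₁ equally
-- rejected; both become minimal, and H₁ does not entail H₀.
module Submission where

open import Defs
open import Data.Bool using (Bool; true; false; not; T)
open import Data.Nat using (ℕ; _≟_)
open import Data.Nat.Properties using (≡ᵇ⇒≡)
open import Data.List using (List; []; _∷_; _++_; foldr; map)
open import Data.List.Relation.Unary.All using (All; []; _∷_)
open import Data.List.Relation.Unary.Any as Any using (here; there)
open import Data.List.Membership.Propositional using (_∈_)
open import Data.List.Relation.Binary.Permutation.Propositional using (_↭_; ↭⇒↭ₛ)
open import Data.List.Relation.Binary.Permutation.Propositional.Properties using (map⁺)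
import Data.List.Relation.Binary.Permutation.Setoid.Properties as PermutationSetoid
open import Data.Product using (_×_; ∃-syntax; _,_)
open import Data.Rational using (ℚ; 0ℚ; 1ℚ; _+_; _≤_)
import Data.Rational.Properties as ℚ
open import Data.Unit using (tt)
open import Data.Empty using (⊥-elim)
open import Relation.Nullary using (¬_; does)
open import Relation.Nullary.Decidable using (dec-true; dec-false)
open import Relation.Binary.PropositionalEquality
  using (_≡_; _≢_; refl; sym; trans; cong; subst; setoid; module ≡-Reasoning)

only : ℕ → Valuation
only H x = does (x ≟ H)

only-self : ∀ H → only H H ≡ true
only-self H = dec-true (H ≟ H) refl

only-other : ∀ {H x} → x ≢ H → only H x ≡ false
only-other {H} {x} = dec-false (x ≟ H)

only-true⇒≡ : ∀ {H x} → only H x ≡ true → x ≡ H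
-- only H x computes to x ≡ᵇ H.
only-true⇒≡ {H} {x} eq = ≡ᵇ⇒≡ x H (subst T (sym eq) tt)

only-satisfies-T : ∀ {𝓗 H} → H ∈ 𝓗 → SatT 𝓗 (only H)
only-satisfies-T {H = H} H∈𝓗 =
  Any.map (λ { refl → only-self H }) H∈𝓗 ,
  λ {H₁} {H₂} _ _ H₁≢H₂ H₁-true →
    only-other {x = H₂} (λ { refl → H₁≢H₂ (only-true⇒≡ {x = H₁} H₁-true) })

holds-at-only : ∀ {𝓗 Γ H} φ → H ∈ 𝓗 → 𝓗 , Γ ⊨ φ →
                All (λ γ → ⟦ γ ⟧ (only H) ≡ true) Γ → ⟦ φ ⟧ (only H) ≡ true
holds-at-only _ H∈𝓗 Γ⊨φ = Γ⊨φ _ (only-satisfies-T H∈𝓗)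

var⊭var : ∀ {𝓗 H H'} → H ∈ 𝓗 → H' ≢ H → ¬ (𝓗 , (var H ∷ []) ⊨ var H')
var⊭var {H = H} H∈𝓗 H'≢H H⊨H'
  with trans (sym (holds-at-only (var _) H∈𝓗 H⊨H' (only-self H ∷ []))) (only-other H'≢H)
... | ()

refuted-at-only : ∀ {𝓗 δ H} → H ∈ 𝓗 → 𝓗 , (δ ∷ []) ⊨ (¬ᶠ var H) → ⟦ δ ⟧ (only H) ≡ false
refuted-at-only {δ = δ} {H} H∈𝓗 δ⊨¬H with ⟦ δ ⟧ (only H) in δ-value
... | false = refl
... | true
  with subst (λ b → not b ≡ true) (only-self H) (holds-at-only (¬ᶠ var H) H∈𝓗 δ⊨¬H (δ-value ∷ []))
... | ()

penalty : Bool → ℚ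
penalty true  = 0ℚ
penalty false = 1ℚ

penalty-nonneg : ∀ b → 0ℚ ≤ penalty b
penalty-nonneg true  = ℚ.≤-refl
penalty-nonneg false = ℚ.<⇒≤ (ℚ.positive⁻¹ 1ℚ)

penalty-antitone : ∀ {a b} → (a ≡ true → b ≡ true) → penalty b ≤ penalty a
penalty-antitone {true}  {true}  _   = ℚ.≤-refl
penalty-antitone {true}  {false} a⇒b with a⇒b refl
... | ()
penalty-antitone {false} {b}     _   = penalty-bounded b
  where
  penalty-bounded : ∀ b → penalty b ≤ 1ℚ
  penalty-bounded true  = ℚ.<⇒≤ (ℚ.positive⁻¹ 1ℚ)
  penalty-bounded false = ℚ.≤-refl

failures : Multiset → ℕ → ℚ
failures Δ H = foldr _+_ 0ℚ (map (λ δ → penalty (⟦ δ ⟧ (only H))) Δ)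

rejection : Multiset → ℕ → Val
rejection Δ H = fin (failures Δ H)

failures-nonneg : ∀ Δ H → 0ℚ ≤ failures Δ H
failures-nonneg []      H = ℚ.≤-refl
failures-nonneg (δ ∷ Δ) H = ℚ.+-mono-≤ (penalty-nonneg (⟦ δ ⟧ (only H))) (failures-nonneg Δ H)

failures-↭ : ∀ {Δ Δ'} H → Δ ↭ Δ' → failures Δ H ≡ failures Δ' H
failures-↭ H Δ↭Δ' =
  PermutationSetoid.foldr-commMonoid (setoid ℚ) ℚ.+-0-isCommutativeMonoid (↭⇒↭ₛ (map⁺ _ Δ↭Δ'))

failures-singleton : ∀ δ H → failures (δ ∷ []) H ≡ penalty (⟦ δ ⟧ (only H))
failures-singleton δ H = ℚ.+-identityʳ _

rejection-additive : ∀ Δ H → rejection Δ H ≡ sumVal (mapL (λ δ → rejection (δ ∷ []) H) Δ)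
rejection-additive []      H = refl
rejection-additive (δ ∷ Δ) H = begin
  fin (penalty (⟦ δ ⟧ (only H)) + failures Δ H)
    ≡⟨ cong (λ p → fin (p + failures Δ H)) (sym (failures-singleton δ H)) ⟩
  rejection (δ ∷ []) H ⊕ rejection Δ H
    ≡⟨ cong (rejection (δ ∷ []) H ⊕_) (rejection-additive Δ H) ⟩
  rejection (δ ∷ []) H ⊕ sumVal (mapL (λ δ → rejection (δ ∷ []) H) Δ) ∎
  where open ≡-Reasoning

rejection-isDegreeOfRejection : ∀ 𝓗 𝓓 → IsDegreeOfRejection 𝓗 𝓓 rejection
rejection-isDegreeOfRejection 𝓗 𝓓 = record
  { nonneg   = λ Δ H _ _ → failures-nonneg Δ H
  ; multiset = λ Δ Δ' H _ Δ↭Δ' _ → cong fin (failures-↭ H Δ↭Δ')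
  ; cond1    = antitone
  ; cond2    = zero-if-entailed
  ; cond3    = positive-if-refuting
  ; cond4    = λ Δ H _ _ _ → rejection-additive Δ H
  }
  where
  antitone : ∀ γ δ H → InFm 𝓓 γ → InFm 𝓓 δ → H ∈ 𝓗 →
             𝓗 , (γ ∷ []) ⊨ δ → rejection (γ ∷ []) H ≥ᵛ rejection (δ ∷ []) H
  antitone γ δ H _ _ H∈𝓗 γ⊨δ
    rewrite failures-singleton γ H | failures-singleton δ H =
    penalty-antitone (λ γ-true → holds-at-only δ H∈𝓗 γ⊨δ (γ-true ∷ []))

  zero-if-entailed : ∀ δ H → InFm 𝓓 δ → H ∈ 𝓗 →
                     𝓗 , (var H ∷ []) ⊨ δ → rejection (δ ∷ []) H ≡ fin 0ℚ
  zero-if-entailed δ H _ H∈𝓗 H⊨δ = cong fin (trans (failures-singleton δ H)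
    (cong penalty (holds-at-only δ H∈𝓗 H⊨δ (only-self H ∷ []))))

  positive-if-refuting : ∀ δ H → InFm 𝓓 δ → H ∈ 𝓗 →
                         𝓗 , (δ ∷ []) ⊨ (¬ᶠ var H) → Pos (rejection (δ ∷ []) H)
  positive-if-refuting δ H _ H∈𝓗 δ⊨¬H =
    subst Pos (cong fin (sym (trans (failures-singleton δ H)
      (cong penalty (refuted-at-only H∈𝓗 δ⊨¬H))))) (ℚ.positive⁻¹ 1ℚ)

≤fin-refl : ∀ x → x ≤fin x
≤fin-refl (fin x) = ℚ.≤-refl
≤fin-refl ∞       = tt

Minimal-of-tie : ∀ {𝓗 r Δ H} → H ∈ 𝓗 → Finite (r Δ H) →
                 (∀ H' → H' ∈ 𝓗 → r Δ H' ≡ r Δ H) → Minimal 𝓗 r Δ H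
Minimal-of-tie {r = r} {Δ} {H} H∈𝓗 finite tie =
  H∈𝓗 , finite , λ H' H'∈𝓗 _ → subst (r Δ H ≤fin_) (sym (tie H' H'∈𝓗)) (≤fin-refl (r Δ H))

¬RJ-of-tie : ∀ {𝓗 Δ H H'} → H ∈ 𝓗 → H' ≢ H →
             (∀ H'' → H'' ∈ 𝓗 → rejection Δ H'' ≡ rejection Δ H) →
             ¬ RJ 𝓗 rejection Δ (var H')
¬RJ-of-tie {Δ = Δ} H∈𝓗 H'≢H tie rj =
  var⊭var H∈𝓗 H'≢H (rj _ (Minimal-of-tie {r = rejection} {Δ} H∈𝓗 tt tie))

𝓗₀ : List ℕ
𝓗₀ = 0 ∷ 1 ∷ []

0∈𝓗₀ : 0 ∈ 𝓗₀
0∈𝓗₀ = here refl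

1∈𝓗₀ : 1 ∈ 𝓗₀
1∈𝓗₀ = there (here refl)

H₀-RJ-H₀ : RJ 𝓗₀ rejection (var 0 ∷ []) (var 0)
H₀-RJ-H₀ .0 (here refl , _)                   _ _ (H₀-true ∷ []) = H₀-true
H₀-RJ-H₀ .1 (there (here refl) , _ , minimal) _ _ _              = ⊥-elim (
  ℚ.<-irrefl refl (ℚ.<-≤-trans (ℚ.positive⁻¹ 1ℚ) (minimal 0 0∈𝓗₀ tt)))

tie-on-𝓗₀ : ∀ Δ → rejection Δ 0 ≡ rejection Δ 1 →
            ∀ H → H ∈ 𝓗₀ → rejection Δ H ≡ rejection Δ 1
tie-on-𝓗₀ Δ tie .0 (here refl)         = tie
tie-on-𝓗₀ Δ tie .1 (there (here refl)) = refl

¬RJ-of-tie-on-𝓗₀ : ∀ Δ → rejection Δ 0 ≡ rejection Δ 1 → ¬ RJ 𝓗₀ rejection Δ (var 0)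
¬RJ-of-tie-on-𝓗₀ Δ tie = ¬RJ-of-tie {Δ = Δ} 1∈𝓗₀ (λ ()) (tie-on-𝓗₀ Δ tie)

proposition2 : (∃[ 𝓗 ] ∃[ 𝓓 ] ∃[ r ] ∃[ γ ] ∃[ δ ] ∃[ φ ]
    (IsDegreeOfRejection 𝓗 𝓓 r × InFm 𝓓 γ × InFm 𝓓 δ × InFm 𝓗 φ
    × RJ 𝓗 r (γ ∷ []) φ × ¬ RJ 𝓗 r ((γ ∧ᶠ δ) ∷ []) φ))
    ×
    (∃[ 𝓗 ] ∃[ 𝓓 ] ∃[ r ] ∃[ Δ ] ∃[ Δ' ] ∃[ φ ]
    (IsDegreeOfRejection 𝓗 𝓓 r × All (InFm 𝓓) Δ × All (InFm 𝓓) Δ' × InFm 𝓗 φ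
    × RJ 𝓗 r Δ φ × ¬ RJ 𝓗 r (Δ ++ Δ') φ))
proposition2 =
  ( 𝓗₀ , 𝓗₀ , rejection , var 0 , ¬ᶠ var 0 , var 0
  , rejection-isDegreeOfRejection 𝓗₀ 𝓗₀ , H₀∈Fm , H₀∈Fm , H₀∈Fm
  , H₀-RJ-H₀ , ¬RJ-of-tie-on-𝓗₀ ((var 0 ∧ᶠ (¬ᶠ var 0)) ∷ []) refl )
  ,
  ( 𝓗₀ , 𝓗₀ , rejection , var 0 ∷ [] , var 1 ∷ [] , var 0
  , rejection-isDegreeOfRejection 𝓗₀ 𝓗₀ , H₀∈Fm ∷ [] , (1∈𝓗₀ ∷ []) ∷ [] , H₀∈Fm
  , H₀-RJ-H₀ , ¬RJ-of-tie-on-𝓗₀ (var 0 ∷ var 1 ∷ []) refl )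
  where
  H₀∈Fm : InFm 𝓗₀ (var 0)
  H₀∈Fm = 0∈𝓗₀ ∷ []
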